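{- Let $r\ge 2$, $n\ge k\ge 2$, $t\ge 1$, and let $s$ be an integer with $1\le s<r$, $\mathbf{s}=(s,\ldots,s)\in\mathbb{Z}^n$. If $n\ge tk$, then \[ \mathrm{cd}^r_{\mathbf{s}}\tbinom{[n]}{k}_{t\text{ -stab}}=\max\{ns-tr(k-1),\,0\}. \] In particular ($t=1$) $\mathrm{cd}^r_{\mathbf{s}}\binom{[n]}{k}=\max\{ns-r(k-1),0\}$, and ($t=2$) $\mathrm{cd}^r_{\mathbf{s}}\binom{[n]}{k}_{\mathrm{stab}}=\max\{ns-2r(k-1),0\}$.
   Context: $[n]=\{1,\ldots,n\}$. A subset $S\subseteq[n]$ is $t$-stable if $t\le|i-j|\le n-t$ for all distinct $i,j\in S$ (distance at least $t$ on the $n$-cycle); $\binom{[n]}{k}_{t\text{ -stab}}$ is the family of all $t$-stable $k$-subsets of $[n]$, $\binom{[n]}{k}$ the family of all $k$-subsets ($=$ the $1$-stable ones), and $\binom{[n]}{k}_{\mathrm{stab}}$ the $2$-stable ones. For multiplicities $\mathbf{s}=(s_1,\ldots,s_n)$ put $\bar n=s_1+\cdots+s_n$; an $r$-tuple $R_1,\ldots,R_r\subseteq[n]$ is $\mathbf{s}$-disjoint if each $i\in[n]$ lies in at most $s_i$ of the $R_j$. For a hypergraph $\mathcal{S}\subseteq 2^{[n]}$, the $\mathbf{s}$-disjoint $r$-colorability defect is \[ \mathrm{cd}^r_{\mathbf{s}}\mathcal{S}=\bar n-\max\Big\{\sum_{j=1}^r|R_j| : R_1,\ldots,R_r\subseteq[n]\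 \mathbf{s}\text{ -disjoint},\ S\not\subseteq R_j \text{ for all } S\in\mathcal{S},\ j\in[r]\Big\}. \] -}

module Defs where

open import Data.Nat using (ℕ; _≤_; _∸_; _+_; ∣_-_∣)
open import Data.Fin using (Fin; toℕ)
open import Data.Fin.Subset using (Subset; _∈_; _⊆_; ∣_∣)
open import Data.Vec using (Vec; lookup; tabulate; sum)
open import Data.Product using (Σ; _×_)
open import Relation.Binary.PropositionalEquality using (_≡_)
open import Relation.Nullary using (¬_)

-- The ground set [n] = {1,…,n} is represented by Fin n (element i ↦ toℕ i + 1;
-- differences are unaffected by the shift).  Subsets of [n] are Subset n.

Hypergraph : ℕ → Set₁
Hypergraph n = Subset n → Set

TStable : (n t : ℕ) → Subset n → Set
TStable n t S = ∀ (i j : Fin n) → i ∈ S → j ∈ S → ¬ (i ≡ j) →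
  (t ≤ ∣ toℕ i - toℕ j ∣) × (∣ toℕ i - toℕ j ∣ ≤ n ∸ t)

StableFamily : (n k t : ℕ) → Hypergraph n
StableFamily n k t S = (∣ S ∣ ≡ k) × TStable n t S

nbar : {n : ℕ} → (Fin n → ℕ) → ℕ
nbar s = sum (tabulate s)

SDisjoint : {n r : ℕ} → (Fin n → ℕ) → (Fin r → Subset n) → Set
SDisjoint {n} s R = ∀ (i : Fin n) → ∣ tabulate (λ j → lookup (R j) i) ∣ ≤ s i

Admissible : {n r : ℕ} → (Fin n → ℕ) → Hypergraph n → (Fin r → Subset n) → Set
Admissible s 𝒮 R = SDisjoint s R × (∀ S j → 𝒮 S → ¬ (S ⊆ R j))

totalSize : {n r : ℕ} → (Fin r → Subset n) → ℕ
totalSize R = sum (tabulate (λ j → ∣ R j ∣))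

IsMaxAdmissible : {n : ℕ} → (r : ℕ) → (Fin n → ℕ) → Hypergraph n → ℕ → Set
IsMaxAdmissible {n} r s 𝒮 m =
  Σ (Fin r → Subset n) (λ R → Admissible s 𝒮 R × (totalSize R ≡ m))
  × (∀ (R : Fin r → Subset n) → Admissible s 𝒮 R → totalSize R ≤ m)

-- cd^r_s 𝒮 = c  :  c = n̄ − max{…}.  (n̄ ≥ max always, so we state it as
-- "c + max = n̄" to avoid truncated subtraction.)
IsColorabilityDefect : {n : ℕ} → (r : ℕ) → (Fin n → ℕ) → Hypergraph n → ℕ → Set
IsColorabilityDefect r s 𝒮 c = Σ ℕ (λ m → IsMaxAdmissible r s 𝒮 m × (c + m ≡ nbar s))

{-# OPTIONS --safe #-}
module Submission where

-- If n ≥ tk, every A ⊆ ℤ/n with |A| > t(k−1) contains a t-stable k-set: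
-- pad A with at most t−1 further points to reach tk points, list these increasingly as
-- p₀ < ⋯ < p_{tk−1}, and pick a residue r mod t that avoids the indices of the padding
-- points.  Then p_r, p_{r+t}, …, p_{r+(k−1)t} lie in A and are pairwise at cyclic
-- distance ≥ t, since consecutive ones are ≥ t apart and the whole run spans at most n − t.
-- So a colour class has at most t(k−1) points, and s-disjointness bounds the total by ns.
--
-- With M = min(rt(k−1), ns), reduce 0, …, M−1 modulo n and give colour j the
-- block [j t(k−1), (j+1) t(k−1)).  A block is an arc of the n-cycle made of k−1 runs of t
-- consecutive points, each meeting a t-stable set at most once, and a residue is hit once
-- per lap around the cycle, i.e. at most ⌈M/n⌉ ≤ s times.

open import Defs
open import Data.Bool.Base using (Bool; true; false; if_then_else_)
open import Data.Fin.Base using (Fin; zero; suc; toℕ; fromℕ<)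
open import Data.Fin.Properties as Fin using (injective⇒≤; any?)
open import Data.Fin.Subset using (Subset; _∈_; _⊆_; ∣_∣; inside; outside)
open import Data.Fin.Subset.Properties using (∣p∣≤n)
open import Data.List.Base using (List; []; _∷_; length; map; filter)
open import Data.List.Membership.Propositional using (_∉_) renaming (_∈_ to _∈ˡ_)
open import Data.List.Membership.Propositional.Properties using (∈-map⁺; ∈-filter⁺)
open import Data.List.Properties using (length-map; filter-notAll)
open import Data.List.Relation.Unary.Any as Any using (here; there)
open import Data.Nat.Base
open import Data.Nat.DivMod
  using (_%_; _/_; _mod_; m≡m%n+[m/n]*n; m%n<n; m<n⇒m%n≡m; [m+n]%n≡m%n; [m+kn]%n≡m%n;
         %-distribˡ-+; m/n*n≤m; m<n*o⇒m/o<n)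
open import Data.Nat.Properties
open import Algebra.Properties.CommutativeMonoid.Sum +-0-commutativeMonoid
  using (∑-comm; sum-cong-≗; sum-syntax) renaming (sum to ∑)
open import Data.List.Membership.DecPropositional _≟_ using (_∈?_)
open import Data.Nat.Tactic.RingSolver using (solve-∀)
open import Data.Product using (∃-syntax; _×_; _,_; proj₁; proj₂)
open import Data.Sum using (_⊎_; inj₁; inj₂)
open import Data.Vec.Base using (_∷_; here; there; lookup; tabulate; sum)
open import Data.Vec.Properties using (lookup∘tabulate; tabulate∘lookup; []=⇒lookup; lookup⇒[]=)
open import Function.Base using (_∘_)
open import Function.Definitions using (Injective)
open import Relation.Binary.Definitions using (tri<; tri≈; tri>)
open import Relation.Binary.PropositionalEquality
  using (_≡_; _≢_; refl; sym; trans; cong; cong₂; subst; subst₂; module ≡-Reasoning)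
open import Relation.Nullary using (¬_; Dec; yes; no; ¬?; contradiction)
open import Relation.Nullary.Decidable using (does; dec-true)
open import Relation.Unary using (Decidable)

private variable
  k n q : ℕ

sum-tabulate : (f : Fin n → ℕ) → sum (tabulate f) ≡ ∑ f
sum-tabulate {zero}  f = refl
sum-tabulate {suc n} f = cong (f zero +_) (sum-tabulate (f ∘ suc))

∑-mono-≤ : {f g : Fin n → ℕ} → (∀ i → f i ≤ g i) → ∑ f ≤ ∑ g
∑-mono-≤ {zero}  f≤g = z≤n
∑-mono-≤ {suc n} f≤g = +-mono-≤ (f≤g zero) (∑-mono-≤ (f≤g ∘ suc))

∑-const : ∀ n x → ∑ {n} (λ _ → x) ≡ n * x
∑-const zero    x = refl
∑-const (suc n) x = cong (x +_) (∑-const n x)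

∑-chunks : ∀ r L M → M ≤ r * L → ∑[ j < r ] (L ⊓ (M ∸ toℕ j * L)) ≡ M
∑-chunks zero    L M M≤0  = sym (n≤0⇒n≡0 M≤0)
∑-chunks (suc r) L M M≤rL = begin
  L ⊓ M + ∑[ j < r ] (L ⊓ (M ∸ (L + toℕ j * L)))  ≡⟨ cong (L ⊓ M +_) rest≡M∸L ⟩
  L ⊓ M + (M ∸ L)                                ≡⟨ m⊓n+n∸m≡n L M ⟩
  M                                              ∎
  where
  open ≡-Reasoning
  rest≡M∸L : ∑[ j < r ] (L ⊓ (M ∸ (L + toℕ j * L))) ≡ M ∸ L
  rest≡M∸L = trans (sum-cong-≗ {r} λ j → cong (L ⊓_) (sym (∸-+-assoc M L (toℕ j * L))))
                   (∑-chunks r L (M ∸ L) (m≤n+o⇒m∸n≤o M L M≤rL))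

χ : Bool → ℕ
χ b = if b then 1 else 0

∣tabulate∣ : (f : Fin n → Bool) → ∣ tabulate f ∣ ≡ ∑ (χ ∘ f)
∣tabulate∣ {zero}  f = refl
∣tabulate∣ {suc n} f with f zero
... | true  = cong suc (∣tabulate∣ (f ∘ suc))
... | false = ∣tabulate∣ (f ∘ suc)

nth : (S : Subset n) → Fin ∣ S ∣ → Fin n
nth (inside  ∷ S) zero    = zero
nth (inside  ∷ S) (suc a) = suc (nth S a)
nth (outside ∷ S) a       = suc (nth S a)

nth∈ : (S : Subset n) (a : Fin ∣ S ∣) → nth S a ∈ S
nth∈ (inside  ∷ S) zero    = here
nth∈ (inside  ∷ S) (suc a) = there (nth∈ S a)
nth∈ (outside ∷ S) a       = there (nth∈ S a)

nth-injective : (S : Subset n) → Injective _≡_ _≡_ (nth S)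
nth-injective (inside  ∷ S) {zero}  {zero}  _ = refl
nth-injective (inside  ∷ S) {suc a} {suc b} e = cong suc (nth-injective S (Fin.suc-injective e))
nth-injective (outside ∷ S)                 e = nth-injective S (Fin.suc-injective e)

rank : {S : Subset n} {i : Fin n} → i ∈ S → Fin ∣ S ∣
rank {S = inside  ∷ S} here      = zero
rank {S = inside  ∷ S} (there p) = suc (rank p)
rank {S = outside ∷ S} (there p) = rank p

nth-rank : {S : Subset n} {i : Fin n} (p : i ∈ S) → nth S (rank p) ≡ i
nth-rank {S = inside  ∷ S} here      = refl
nth-rank {S = inside  ∷ S} (there p) = cong suc (nth-rank p)
nth-rank {S = outside ∷ S} (there p) = cong suc (nth-rank p)

injection⇒∣p∣≤ : (S : Subset n) (f : ∀ {i} → i ∈ S → Fin q) →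
  (∀ {i j} (p : i ∈ S) (p′ : j ∈ S) → f p ≡ f p′ → i ≡ j) → ∣ S ∣ ≤ q
injection⇒∣p∣≤ S f f-inj = injective⇒≤ (nth-injective S ∘ f-inj (nth∈ S _) (nth∈ S _))

injection⇒≤∣p∣ : (S : Subset n) (h : Fin k → Fin n) → Injective _≡_ _≡_ h →
  (∀ a → h a ∈ S) → k ≤ ∣ S ∣
injection⇒≤∣p∣ S h h-inj h∈S = injective⇒≤ λ {a} {b} e →
  h-inj (trans (sym (nth-rank (h∈S a))) (trans (cong (nth S) e) (nth-rank (h∈S b))))

fromDec : {P : Fin n → Set} → Decidable P → Subset n
fromDec P? = tabulate (does ∘ P?)

∈-fromDec⁺ : {P : Fin n → Set} (P? : Decidable P) {i : Fin n} → P i → i ∈ fromDec P?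
∈-fromDec⁺ P? {i} Pi = lookup⇒[]= i _ (trans (lookup∘tabulate _ i) (dec-true (P? i) Pi))

∈-fromDec⁻ : {P : Fin n → Set} (P? : Decidable P) {i : Fin n} → i ∈ fromDec P? → P i
∈-fromDec⁻ P? {i} p with P? i | trans (sym (lookup∘tabulate _ i)) ([]=⇒lookup p)
... | yes Pi | _ = Pi

preimage? : (h : Fin k → Fin n) → Decidable (λ i → ∃[ a ] h a ≡ i)
preimage? h i = any? (λ a → h a Fin.≟ i)

image : (Fin k → Fin n) → Subset n
image h = fromDec (preimage? h)

∈-image⁺ : (h : Fin k → Fin n) (a : Fin k) → h a ∈ image h
∈-image⁺ h a = ∈-fromDec⁺ (preimage? h) (a , refl)

∈-image⁻ : (h : Fin k → Fin n) {i : Fin n} → i ∈ image h → ∃[ a ] h a ≡ i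
∈-image⁻ h = ∈-fromDec⁻ (preimage? h)

∣image∣ : (h : Fin k → Fin n) → Injective _≡_ _≡_ h → ∣ image h ∣ ≡ k
∣image∣ h h-inj = ≤-antisym
  (injection⇒∣p∣≤ (image h) (proj₁ ∘ ∈-image⁻ h)
    (λ p p′ e → trans (sym (proj₂ (∈-image⁻ h p))) (trans (cong h e) (proj₂ (∈-image⁻ h p′)))))
  (injection⇒≤∣p∣ (image h) h h-inj (∈-image⁺ h))

totalSize≤nbar : ∀ {n r} {s : Fin n → ℕ} {R : Fin r → Subset n} →
  SDisjoint s R → totalSize R ≤ nbar s
totalSize≤nbar {n} {r} {s} {R} disjoint = begin
  totalSize R                                      ≡⟨ sum-tabulate (λ j → ∣ R j ∣) ⟩
  ∑[ j < r ] ∣ R j ∣                                ≡⟨ sum-cong-≗ {r} (λ j → ∣p∣≡∑ (R j)) ⟩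
  ∑[ j < r ] ∑[ i < n ] χ (lookup (R j) i)         ≡⟨ ∑-comm (λ j i → χ (lookup (R j) i)) ⟩
  ∑[ i < n ] ∑[ j < r ] χ (lookup (R j) i)         ≡⟨ sum-cong-≗ {n} (∣tabulate∣ ∘ column) ⟨
  ∑[ i < n ] ∣ tabulate (column i) ∣               ≤⟨ ∑-mono-≤ disjoint ⟩
  ∑[ i < n ] s i                                    ≡⟨ sum-tabulate s ⟨
  nbar s                                            ∎
  where
  open ≤-Reasoning
  column : Fin n → Fin r → Bool
  column i j = lookup (R j) i
  ∣p∣≡∑ : ∀ {n} (p : Subset n) → ∣ p ∣ ≡ ∑[ i < n ] χ (lookup p i)
  ∣p∣≡∑ p = trans (cong ∣_∣ (sym (tabulate∘lookup p))) (∣tabulate∣ (lookup p))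

totalSize≤ : ∀ {n r L} {R : Fin r → Subset n} → (∀ j → ∣ R j ∣ ≤ L) → totalSize R ≤ r * L
totalSize≤ {r = r} {L} {R} ∣R∣≤L = begin
  totalSize R         ≡⟨ sum-tabulate (λ j → ∣ R j ∣) ⟩
  ∑[ j < r ] ∣ R j ∣  ≤⟨ ∑-mono-≤ ∣R∣≤L ⟩
  ∑[ j < r ] L        ≡⟨ ∑-const r L ⟩
  r * L               ∎
  where open ≤-Reasoning

nbar-const : ∀ n s → nbar {n} (λ _ → s) ≡ n * s
nbar-const n s = trans (sum-tabulate {n} (λ _ → s)) (∑-const n s)

-- Large sets contain t-stable k-sets

Apart : ℕ → ℕ → ℕ → ℕ → Set
Apart n t x y = t ≤ ∣ x - y ∣ × ∣ x - y ∣ ≤ n ∸ t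

Apart-sym : ∀ {n t} x y → Apart n t x y → Apart n t y x
Apart-sym {n} {t} x y = subst (λ z → t ≤ z × z ≤ n ∸ t) (∣-∣-comm x y)

¬Apart-refl : ∀ {n t} .{{_ : NonZero t}} x → ¬ Apart n t x x
¬Apart-refl {t = t} x (t≤∣x-x∣ , _) =
  <⇒≱ (>-nonZero⁻¹ t) (subst (t ≤_) (∣n-n∣≡0 x) t≤∣x-x∣)

stableFamily-image : ∀ {t} .{{_ : NonZero t}} (h : Fin k → Fin n) →
  (∀ {i j} → toℕ i < toℕ j → Apart n t (toℕ (h i)) (toℕ (h j))) →
  StableFamily n k t (image h)
stableFamily-image {k} {n} {t} h h-apart = ∣image∣ h h-injective , stable
  where
  apart-≢ : ∀ {i j} → i ≢ j → Apart n t (toℕ (h i)) (toℕ (h j))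
  apart-≢ {i} {j} i≢j with <-cmp (toℕ i) (toℕ j)
  ... | tri< i<j _ _ = h-apart i<j
  ... | tri≈ _ i≡j _ = contradiction (Fin.toℕ-injective i≡j) i≢j
  ... | tri> _ _ j<i = Apart-sym (toℕ (h j)) (toℕ (h i)) (h-apart j<i)
  h-injective : Injective _≡_ _≡_ h
  h-injective {i} {j} hi≡hj with i Fin.≟ j
  ... | yes i≡j = i≡j
  ... | no  i≢j = contradiction (subst (λ y → Apart n t (toℕ (h i)) (toℕ y)) (sym hi≡hj) (apart-≢ i≢j))
                                (¬Apart-refl (toℕ (h i)))
  stable : TStable n t (image h)
  stable x y x∈ y∈ x≢y with i , refl ← ∈-image⁻ h x∈ | j , refl ← ∈-image⁻ h y∈ =
    apart-≢ (x≢y ∘ cong h)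

missing-below : ∀ t (xs : List ℕ) → length xs < t → ∃[ r ] r < t × r ∉ xs
missing-below (suc t) xs |xs|≤t with t ∈? xs
... | no  t∉xs = t , ≤-refl , t∉xs
... | yes t∈xs
  with r , r<t , r∉ys ← missing-below t (filter (λ x → ¬? (x ≟ t)) xs)
         (<-≤-trans (filter-notAll _ xs (Any.map (λ t≡x x≢t → x≢t (sym t≡x)) t∈xs))
                    (s≤s⁻¹ |xs|≤t))
  = r , m<n⇒m<1+n r<t , λ r∈xs → r∉ys (∈-filter⁺ _ r∈xs (<⇒≢ r<t))

record Selection (A : Subset n) (N b : ℕ) : Set where
  field
    pos         : ℕ → ℕ
    padding     : List ℕ
    few-padding : length padding ≤ b
    increasing  : ∀ {j} → suc j < N → pos j < pos (suc j)
    bounded     : ∀ {j} → j < N → pos j < n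
    selects     : ∀ {j} → j < N → j ∉ padding → ∀ i → toℕ i ≡ pos j → i ∈ A

module _ {A : Subset n} {N b : ℕ} (σ : Selection A N b) where
  open Selection σ

  shift : ∀ {x} → Selection (x ∷ A) N b
  shift = record
    { pos         = suc ∘ pos
    ; padding     = padding
    ; few-padding = few-padding
    ; increasing  = s≤s ∘ increasing
    ; bounded     = s≤s ∘ bounded
    ; selects     = λ { j<N j∉ (suc i) e → there (selects j<N j∉ i (suc-injective e)) }
    }

  private
    pos₀ : ℕ → ℕ
    pos₀ zero    = zero
    pos₀ (suc j) = suc (pos j)

    increasing₀ : ∀ {j} → suc j < suc N → pos₀ j < pos₀ (suc j)
    increasing₀ {zero}  _         = s≤s z≤n
    increasing₀ {suc j} (s≤s j<N) = s≤s (increasing j<N)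

    bounded₀ : ∀ {j} → j < suc N → pos₀ j < suc n
    bounded₀ {zero}  _         = s≤s z≤n
    bounded₀ {suc j} (s≤s j<N) = s≤s (bounded j<N)

    selects₀ : ∀ {x j} → suc j < suc N → suc j ∉ map suc padding →
               ∀ i → toℕ i ≡ pos₀ (suc j) → i ∈ x ∷ A
    selects₀ (s≤s j<N) j∉ (suc i) e = there (selects j<N (j∉ ∘ ∈-map⁺ suc) i (suc-injective e))

  take-first : Selection (inside ∷ A) (suc N) b
  take-first = record
    { pos         = pos₀
    ; padding     = map suc padding
    ; few-padding = subst (_≤ b) (sym (length-map suc padding)) few-padding
    ; increasing  = increasing₀
    ; bounded     = bounded₀
    ; selects     = λ { {zero} _ _ zero _ → here ; {suc j} j<N j∉ → selects₀ j<N j∉ }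
    }

  pad-first : Selection (outside ∷ A) (suc N) (suc b)
  pad-first = record
    { pos         = pos₀
    ; padding     = 0 ∷ map suc padding
    ; few-padding = s≤s (subst (_≤ b) (sym (length-map suc padding)) few-padding)
    ; increasing  = increasing₀
    ; bounded     = bounded₀
    ; selects     = λ { {zero} _ 0∉ → λ _ _ → contradiction (here refl) 0∉
                      ; {suc j} j<N j∉ → selects₀ j<N (j∉ ∘ there) }
    }

  spread : ∀ u d → u + d < N → pos u + d ≤ pos (u + d)
  spread u zero    _       = ≤-reflexive (trans (+-identityʳ (pos u)) (cong pos (sym (+-identityʳ u))))
  spread u (suc d) u+d<N = begin
    pos u + suc d     ≡⟨ +-suc (pos u) d ⟩
    suc (pos u + d)   ≤⟨ s≤s (spread u d (<-trans (n<1+n (u + d)) u+d+1<N)) ⟩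
    suc (pos (u + d)) ≤⟨ increasing u+d+1<N ⟩
    pos (suc (u + d)) ≡⟨ cong pos (+-suc u d) ⟨
    pos (u + suc d)   ∎
    where
    open ≤-Reasoning
    u+d+1<N : suc (u + d) < N
    u+d+1<N = subst (_< N) (+-suc u d) u+d<N

  index≤pos : ∀ {j} → j < N → j ≤ pos j
  index≤pos {j} j<N = m+n≤o⇒n≤o (pos 0) (spread 0 j j<N)

  room : ∀ {j} → j < N → pos j + N ≤ n + j
  room {j} j<N with c , j+1+c≡N ← m≤n⇒∃[o]m+o≡n j<N = begin
    pos j + N             ≡⟨ cong (pos j +_) j+1+c≡N ⟨
    pos j + (suc j + c)   ≡⟨ shuffle (pos j) j c ⟩
    suc (pos j + c) + j   ≤⟨ +-monoˡ-≤ j (s≤s (spread j c j+c<N)) ⟩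
    suc (pos (j + c)) + j ≤⟨ +-monoˡ-≤ j (bounded j+c<N) ⟩
    n + j                 ∎
    where
    open ≤-Reasoning
    shuffle : ∀ p j c → p + (suc j + c) ≡ suc (p + c) + j
    shuffle = solve-∀
    j+c<N : j + c < N
    j+c<N = subst (j + c <_) j+1+c≡N ≤-refl

  distance : ∀ u d → u + d < N → ∃[ e ] pos (u + d) ≡ pos u + e × d ≤ e × e + N ≤ n + d
  distance u d u+d<N = e , sym pos[u]+e , d≤e , +-cancelˡ-≤ (pos u) (e + N) (n + d) bound
    where
    open ≤-Reasoning
    gap = spread u d u+d<N
    e = pos (u + d) ∸ pos u
    pos[u]+e : pos u + e ≡ pos (u + d)
    pos[u]+e = m+[n∸m]≡n (m+n≤o⇒m≤o (pos u) gap)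
    d≤e : d ≤ e
    d≤e = +-cancelˡ-≤ (pos u) d e (subst (pos u + d ≤_) (sym pos[u]+e) gap)
    swap : ∀ p n d → n + (p + d) ≡ p + (n + d)
    swap = solve-∀
    bound : pos u + (e + N) ≤ pos u + (n + d)
    bound = begin
      pos u + (e + N)   ≡⟨ +-assoc (pos u) e N ⟨
      pos u + e + N     ≡⟨ cong (_+ N) pos[u]+e ⟩
      pos (u + d) + N   ≤⟨ room u+d<N ⟩
      n + (u + d)       ≤⟨ +-monoʳ-≤ n (+-monoˡ-≤ d (index≤pos (≤-<-trans (m≤m+n u d) u+d<N))) ⟩
      n + (pos u + d)   ≡⟨ swap (pos u) n d ⟩
      pos u + (n + d)   ∎

  pos-apart : ∀ {t} u d → u + d < N → t ≤ d → d + t ≤ N → Apart n t (pos u) (pos (u + d))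
  pos-apart {t} u d u+d<N t≤d d+t≤N with e , eq , d≤e , e+N≤n+d ← distance u d u+d<N
    rewrite eq | ∣m-m+n∣≡n (pos u) e =
      ≤-trans t≤d d≤e , m+n≤o⇒m≤o∸n e (+-cancelʳ-≤ d (e + t) n e+t+d≤n+d)
    where
    e+t+d≤n+d : e + t + d ≤ n + d
    e+t+d≤n+d = begin
      e + t + d   ≡⟨ +-assoc e t d ⟩
      e + (t + d) ≡⟨ cong (e +_) (+-comm t d) ⟩
      e + (d + t) ≤⟨ +-monoʳ-≤ e d+t≤N ⟩
      e + N       ≤⟨ e+N≤n+d ⟩
      n + d       ∎
      where open ≤-Reasoning

select : (A : Subset n) (N b : ℕ) → N ≤ n → N ≤ ∣ A ∣ + b → Selection A N b
select A zero b _ _ = record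
  { pos = λ j → j ; padding = [] ; few-padding = z≤n
  ; increasing = λ () ; bounded = λ () ; selects = λ () }
select (inside  ∷ A) (suc N) b       (s≤s N≤n) (s≤s N≤) = take-first (select A N b N≤n N≤)
select (outside ∷ A) (suc N) (suc b) (s≤s N≤n) N<      =
  pad-first (select A N b N≤n (s≤s⁻¹ (subst (suc N ≤_) (+-suc ∣ A ∣ b) N<)))
select (outside ∷ A) (suc N) zero    _         N≤      =
  shift (select A (suc N) zero (≤-trans N≤ (≤-trans (≤-reflexive (+-identityʳ ∣ A ∣)) (∣p∣≤n A)))
               N≤)

module _ {A : Subset n} {t k b : ℕ} .{{_ : NonZero t}} (σ : Selection A (t * k) b) where
  open Selection σ

  residue-class-stable : ∀ {r} → r < t → r ∉ map (_% t) padding →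
    ∃[ S ] StableFamily n k t S × S ⊆ A
  residue-class-stable {r} r<t r∉ = image h , stableFamily-image h h-apart , image⊆A
    where
    a : ℕ → ℕ
    a x = r + x * t

    a<N : ∀ {x} → x < k → a x < t * k
    a<N {x} x<k = begin-strict
      r + x * t <⟨ +-monoˡ-< (x * t) r<t ⟩
      suc x * t ≤⟨ *-monoˡ-≤ t x<k ⟩
      k * t     ≡⟨ *-comm k t ⟩
      t * k     ∎
      where open ≤-Reasoning

    a∉ : ∀ x → a x ∉ padding
    a∉ x a∈ = r∉ (subst (_∈ˡ map (_% t) padding) a%t≡r (∈-map⁺ (_% t) a∈))
      where
      a%t≡r : a x % t ≡ r
      a%t≡r = trans ([m+kn]%n≡m%n r x t) (m<n⇒m%n≡m r<t)

    a-apart : ∀ x δ → suc x + δ < k → Apart n t (pos (a x)) (pos (a (suc x + δ)))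
    a-apart x δ y<k = subst (λ z → Apart n t (pos (a x)) (pos z)) (sym (a-step r x δ t))
      (pos-apart σ (a x) (suc δ * t) (subst (_< t * k) (a-step r x δ t) (a<N y<k))
                 (m≤m+n t (δ * t)) d+t≤N)
      where
      a-step : ∀ r x δ t → r + (suc x + δ) * t ≡ (r + x * t) + suc δ * t
      a-step = solve-∀
      d+t≤N : suc δ * t + t ≤ t * k
      d+t≤N = begin
        suc δ * t + t     ≡⟨ +-comm (suc δ * t) t ⟩
        suc (suc δ) * t   ≤⟨ *-monoˡ-≤ t (≤-trans (s≤s (s≤s (m≤n+m δ x))) y<k) ⟩
        k * t             ≡⟨ *-comm k t ⟩
        t * k             ∎
        where open ≤-Reasoning

    h : Fin k → Fin n
    h i = fromℕ< (bounded (a<N (Fin.toℕ<n i)))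

    h-apart : ∀ {i j} → toℕ i < toℕ j → Apart n t (toℕ (h i)) (toℕ (h j))
    h-apart {i} {j} i<j with δ , i+1+δ≡j ← m≤n⇒∃[o]m+o≡n i<j
      rewrite Fin.toℕ-fromℕ< (bounded (a<N (Fin.toℕ<n i)))
            | Fin.toℕ-fromℕ< (bounded (a<N (Fin.toℕ<n j)))
            | sym i+1+δ≡j
      = a-apart (toℕ i) δ (subst (_< k) (sym i+1+δ≡j) (Fin.toℕ<n j))

    image⊆A : image h ⊆ A
    image⊆A x∈ with i , refl ← ∈-image⁻ h x∈ =
      selects (a<N (Fin.toℕ<n i)) (a∉ (toℕ i)) (h i) (Fin.toℕ-fromℕ< _)

stable-subset : ∀ {t k} .{{_ : NonZero t}} (A : Subset n) → t * suc k ≤ n → t * k < ∣ A ∣ →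
  ∃[ S ] StableFamily n (suc k) t S × S ⊆ A
stable-subset {t = t} {k} A N≤n tk<∣A∣ =
  let r , r<t , r∉ = missing-below t (map (_% t) (padding σ)) (m≤pred[n]⇒suc[m]≤n #residues≤)
  in  residue-class-stable σ r<t r∉
  where
  open Selection using (padding; few-padding)
  N≤∣A∣+b : t * suc k ≤ ∣ A ∣ + pred t
  N≤∣A∣+b = begin
    t * suc k              ≡⟨ *-suc t k ⟩
    t + t * k              ≡⟨ cong (_+ t * k) (suc-pred t) ⟨
    suc (pred t + t * k)   ≡⟨ +-suc (pred t) (t * k) ⟨
    pred t + suc (t * k)   ≤⟨ +-monoʳ-≤ (pred t) tk<∣A∣ ⟩
    pred t + ∣ A ∣         ≡⟨ +-comm (pred t) ∣ A ∣ ⟩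
    ∣ A ∣ + pred t         ∎
    where open ≤-Reasoning
  σ : Selection A (t * suc k) (pred t)
  σ = select A (t * suc k) (pred t) N≤n N≤∣A∣+b
  #residues≤ : length (map (_% t) (padding σ)) ≤ pred t
  #residues≤ = subst (_≤ pred t) (sym (length-map (_% t) (padding σ))) (few-padding σ)

∣avoiding∣≤ : ∀ {t k} .{{_ : NonZero t}} → t * suc k ≤ n → (R : Subset n) →
  (∀ S → StableFamily n (suc k) t S → ¬ S ⊆ R) → ∣ R ∣ ≤ t * k
∣avoiding∣≤ N≤n R avoids = ≮⇒≥ λ tk<∣R∣ →
  let S , stable , S⊆R = stable-subset R N≤n tk<∣R∣ in avoids S stable S⊆R

-- Residues on the n-cycle

m<o∸n⇒n+m<o : ∀ n {m o} → m < o ∸ n → n + m < o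
m<o∸n⇒n+m<o zero                m<o   = m<o
m<o∸n⇒n+m<o (suc n) {o = suc o} m<o∸n = s≤s (m<o∸n⇒n+m<o n m<o∸n)

m<n⇒m*o+p<n*o+q : ∀ {m n o p} q → m < n → p < o → m * o + p < n * o + q
m<n⇒m*o+p<n*o+q {m} {n} {o} {p} q m<n p<o = begin-strict
  m * o + p    <⟨ +-monoʳ-< (m * o) p<o ⟩
  m * o + o    ≡⟨ +-comm (m * o) o ⟩
  suc m * o    ≤⟨ *-monoˡ-≤ o m<n ⟩
  n * o        ≤⟨ m≤m+n (n * o) q ⟩
  n * o + q    ∎
  where open ≤-Reasoning

m*o+p≡n*o+q⇒m≡n : ∀ {o p q} m n → p < o → q < o → m * o + p ≡ n * o + q → m ≡ n
m*o+p≡n*o+q⇒m≡n {p = p} {q} m n p<o q<o eq with <-cmp m n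
... | tri< m<n _ _ = contradiction eq (<⇒≢ (m<n⇒m*o+p<n*o+q q m<n p<o))
... | tri≈ _ m≡n _ = m≡n
... | tri> _ _ n<m = contradiction (sym eq) (<⇒≢ (m<n⇒m*o+p<n*o+q p n<m q<o))

m/o≡n/o⇒n<m+o : ∀ {a b t} .{{_ : NonZero t}} → a / t ≡ b / t → b < a + t
m/o≡n/o⇒n<m+o {a} {b} {t} a/t≡b/t = begin-strict
  b                   ≡⟨ m≡m%n+[m/n]*n b t ⟩
  b % t + b / t * t   <⟨ +-monoˡ-< (b / t * t) (m%n<n b t) ⟩
  t + b / t * t       ≡⟨ cong (λ q → t + q * t) a/t≡b/t ⟨
  t + a / t * t       ≤⟨ +-monoʳ-≤ t (m/n*n≤m a t) ⟩
  t + a               ≡⟨ +-comm t a ⟩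
  a + t               ∎
  where open ≤-Reasoning

module _ {n : ℕ} .{{_ : NonZero n}} where

  %-+-cases : ∀ x {d} → d < n → (x + d) % n ≡ x % n + d ⊎ (x + d) % n + n ≡ x % n + d
  %-+-cases x {d} d<n = cases (x % n + d <? n)
    where
    open ≡-Reasoning
    y = x % n + d
    [x+d]%n≡y%n : (x + d) % n ≡ y % n
    [x+d]%n≡y%n = trans (%-distribˡ-+ x d n) (cong (λ z → (x % n + z) % n) (m<n⇒m%n≡m d<n))
    cases : Dec (y < n) → (x + d) % n ≡ y ⊎ (x + d) % n + n ≡ y
    cases (yes y<n) = inj₁ (trans [x+d]%n≡y%n (m<n⇒m%n≡m y<n))
    cases (no  y≮n) = inj₂ (begin
      (x + d) % n + n       ≡⟨ cong (_+ n) [x+d]%n≡y%n ⟩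
      y % n + n             ≡⟨ cong (λ z → z % n + n) (m∸n+n≡m n≤y) ⟨
      (y ∸ n + n) % n + n   ≡⟨ cong (_+ n) ([m+n]%n≡m%n (y ∸ n) n) ⟩
      (y ∸ n) % n + n       ≡⟨ cong (_+ n) (m<n⇒m%n≡m y∸n<n) ⟩
      y ∸ n + n             ≡⟨ m∸n+n≡m n≤y ⟩
      y                     ∎)
      where
      n≤y : n ≤ y
      n≤y = ≮⇒≥ y≮n
      y∸n<n : y ∸ n < n
      y∸n<n = +-cancelʳ-< n (y ∸ n) n (subst (_< n + n) (sym (m∸n+n≡m n≤y)) (+-mono-< (m%n<n x n) d<n))

  cyclic-distance : ∀ x {d} → d < n →
    ∣ x % n - (x + d) % n ∣ ≡ d ⊎ ∣ x % n - (x + d) % n ∣ + d ≡ n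
  cyclic-distance x {d} d<n with %-+-cases x d<n
  ... | inj₁ eq = inj₁ (trans (cong (∣ x % n -_∣) eq) (∣m-m+n∣≡n (x % n) d))
  ... | inj₂ eq = inj₂ (+-cancelˡ-≡ y _ _ (begin
      y + (∣ x % n - y ∣ + d) ≡⟨ +-assoc y _ d ⟨
      y + ∣ x % n - y ∣ + d   ≡⟨ cong (λ z → y + z + d) (m≤n⇒∣n-m∣≡n∸m y≤x%n) ⟩
      y + (x % n ∸ y) + d     ≡⟨ cong (_+ d) (m+[n∸m]≡n y≤x%n) ⟩
      x % n + d               ≡⟨ eq ⟨
      y + n                   ∎))
    where
    open ≡-Reasoning
    y = (x + d) % n
    y≤x%n : y ≤ x % n
    y≤x%n = +-cancelʳ-≤ d y (x % n) (≤-trans (+-monoʳ-≤ y (<⇒≤ d<n)) (≤-reflexive eq))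

  %-injective-ordered : ∀ {x y} → x ≤ y → y < x + n → x % n ≡ y % n → x ≡ y
  %-injective-ordered {x} x≤y y<x+n eq with d , refl ← m≤n⇒∃[o]m+o≡n x≤y
    with d<n ← +-cancelˡ-< x d n y<x+n
    with cyclic-distance x d<n
  ... | inj₁ ∣∣≡d   = sym (trans (cong (x +_) d≡0) (+-identityʳ x))
    where
    d≡0 = trans (sym ∣∣≡d) (m≡n⇒∣m-n∣≡0 eq)
  ... | inj₂ ∣∣+d≡n =
    contradiction (trans (cong (_+ d) (sym (m≡n⇒∣m-n∣≡0 eq))) ∣∣+d≡n) (<⇒≢ d<n)

  %-injective-window : ∀ {x y} → y < x + n → x < y + n → x % n ≡ y % n → x ≡ y
  %-injective-window {x} {y} y<x+n x<y+n eq with ≤-total x y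
  ... | inj₁ x≤y = %-injective-ordered x≤y y<x+n eq
  ... | inj₂ y≤x = sym (%-injective-ordered y≤x x<y+n (sym eq))

  ¬Apart-ordered : ∀ {t x y} → t ≤ n → x ≤ y → y < x + t → ¬ Apart n t (x % n) (y % n)
  ¬Apart-ordered {t} {x} t≤n x≤y y<x+t with d , refl ← m≤n⇒∃[o]m+o≡n x≤y
    with d<t ← +-cancelˡ-< x d t y<x+t
    with cyclic-distance x (<-≤-trans d<t t≤n)
  ... | inj₁ ∣∣≡d   = λ (t≤∣∣ , _) → <⇒≱ d<t (subst (t ≤_) ∣∣≡d t≤∣∣)
  ... | inj₂ ∣∣+d≡n = λ (_ , ∣∣≤n∸t) → <⇒≱ d<t (+-cancelˡ-≤ _ t d
                        (≤-trans (m≤o∸n⇒m+n≤o _ t≤n ∣∣≤n∸t) (≤-reflexive (sym ∣∣+d≡n))))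

  ¬Apart-window : ∀ {t x y} → t ≤ n → y < x + t → x < y + t → ¬ Apart n t (x % n) (y % n)
  ¬Apart-window {t} {x} {y} t≤n y<x+t x<y+t with ≤-total x y
  ... | inj₁ x≤y = ¬Apart-ordered t≤n x≤y y<x+t
  ... | inj₂ y≤x = ¬Apart-ordered t≤n y≤x x<y+t ∘ Apart-sym (x % n) (y % n)

  %-/-injective : ∀ {x y} → x % n ≡ y % n → x / n ≡ y / n → x ≡ y
  %-/-injective {x} {y} x%n≡y%n x/n≡y/n = begin
    x                 ≡⟨ m≡m%n+[m/n]*n x n ⟩
    x % n + x / n * n ≡⟨ cong₂ (λ u v → u + v * n) x%n≡y%n x/n≡y/n ⟩
    y % n + y / n * n ≡⟨ m≡m%n+[m/n]*n y n ⟨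
    y                 ∎
    where open ≡-Reasoning

-- The extremal colouring by arcs

module _ {n : ℕ} .{{_ : NonZero n}} where

  toℕ-mod : ∀ m → toℕ (m mod n) ≡ m % n
  toℕ-mod m = Fin.toℕ-fromℕ< _

  arc : ℕ → ℕ → Subset n
  arc c ℓ = image (λ (a : Fin ℓ) → (c + toℕ a) mod n)

  ∈-arc⁻ : ∀ {c ℓ i} → i ∈ arc c ℓ → ∃[ a ] a < ℓ × toℕ i ≡ (c + a) % n
  ∈-arc⁻ {c} {ℓ} i∈ with a , refl ← ∈-image⁻ (λ (a : Fin ℓ) → (c + toℕ a) mod n) i∈ =
    toℕ a , Fin.toℕ<n a , toℕ-mod (c + toℕ a)

  ∣arc∣ : ∀ c {ℓ} → ℓ ≤ n → ∣ arc c ℓ ∣ ≡ ℓ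
  ∣arc∣ c {ℓ} ℓ≤n = ∣image∣ _ λ {a} {a′} eq → Fin.toℕ-injective (+-cancelˡ-≡ c _ _
    (%-injective-window (within a a′) (within a′ a)
      (trans (sym (toℕ-mod (c + toℕ a))) (trans (cong toℕ eq) (toℕ-mod (c + toℕ a′))))))
    where
    within : ∀ (a a′ : Fin ℓ) → c + toℕ a′ < c + toℕ a + n
    within a a′ =
      <-≤-trans (+-monoʳ-< c (<-≤-trans (Fin.toℕ<n a′) ℓ≤n)) (+-monoˡ-≤ n (m≤m+n c (toℕ a)))

  ∣stable∩arc∣≤ : ∀ {t k c ℓ} .{{_ : NonZero t}} → t ≤ n → ℓ ≤ t * k →
    (S : Subset n) → S ⊆ arc c ℓ → TStable n t S → ∣ S ∣ ≤ k
  ∣stable∩arc∣≤ {t} {k} {c} {ℓ} t≤n ℓ≤tk S S⊆arc stable =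
    injection⇒∣p∣≤ S block block-injective
    where
    on-arc : ∀ {i} → i ∈ S → ∃[ a ] a < ℓ × toℕ i ≡ (c + a) % n
    on-arc p = ∈-arc⁻ {c} {ℓ} (S⊆arc p)
    offset : ∀ {i} → i ∈ S → ℕ
    offset = proj₁ ∘ on-arc
    offset<ℓ : ∀ {i} (p : i ∈ S) → offset p < ℓ
    offset<ℓ = proj₁ ∘ proj₂ ∘ on-arc
    toℕ≡ : ∀ {i} (p : i ∈ S) → toℕ i ≡ (c + offset p) % n
    toℕ≡ = proj₂ ∘ proj₂ ∘ on-arc
    block< : ∀ {i} (p : i ∈ S) → offset p / t < k
    block< p = m<n*o⇒m/o<n (<-≤-trans (offset<ℓ p) (≤-trans ℓ≤tk (≤-reflexive (*-comm t k))))
    block : ∀ {i} → i ∈ S → Fin k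
    block p = fromℕ< (block< p)
    close : ∀ {i j} (p : i ∈ S) (q : j ∈ S) → block p ≡ block q → c + offset q < c + offset p + t
    close p q eq = begin-strict
      c + offset q         <⟨ +-monoʳ-< c (m/o≡n/o⇒n<m+o (trans (sym (Fin.toℕ-fromℕ< (block< p)))
                                            (trans (cong toℕ eq) (Fin.toℕ-fromℕ< (block< q))))) ⟩
      c + (offset p + t)   ≡⟨ +-assoc c (offset p) t ⟨
      c + offset p + t     ∎
      where open ≤-Reasoning
    block-injective : ∀ {i j} (p : i ∈ S) (q : j ∈ S) → block p ≡ block q → i ≡ j
    block-injective {i} {j} p q eq with i Fin.≟ j
    ... | yes i≡j = i≡j
    ... | no  i≢j = contradiction (subst₂ (Apart n t) (toℕ≡ p) (toℕ≡ q) (stable i j p q i≢j))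
                                  (¬Apart-window t≤n (close p q eq) (close q p (sym eq)))

  module _ (r L M : ℕ) where

    start size : Fin r → ℕ
    start j = toℕ j * L
    size  j = L ⊓ (M ∸ start j)

    -- Colour j gets the block [jL, jL + L) ∩ [0, M) reduced mod n, empty once jL ≥ M.
    arcs : Fin r → Subset n
    arcs j = arc (start j) (size j)

    totalSize-arcs : L ≤ n → M ≤ r * L → totalSize arcs ≡ M
    totalSize-arcs L≤n M≤rL = begin
      totalSize arcs                       ≡⟨ sum-tabulate (λ j → ∣ arcs j ∣) ⟩
      ∑[ j < r ] ∣ arcs j ∣                ≡⟨ sum-cong-≗ (λ j → ∣arc∣ (start j) (≤-trans (m⊓n≤m L _) L≤n)) ⟩
      ∑[ j < r ] size j                    ≡⟨ ∑-chunks r L M M≤rL ⟩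
      M                                    ∎
      where open ≡-Reasoning

    arcs-avoid : ∀ {t k} .{{_ : NonZero t}} → t ≤ n → L ≤ t * k →
      ∀ S j → StableFamily n (suc k) t S → ¬ S ⊆ arcs j
    arcs-avoid {k = k} t≤n L≤tk S j (∣S∣≡1+k , stable) S⊆ =
      1+n≰n (subst (_≤ k) ∣S∣≡1+k (∣stable∩arc∣≤ t≤n (≤-trans (m⊓n≤m L _) L≤tk) S S⊆ stable))

    arcs-sDisjoint : ∀ {s} → M ≤ n * s → SDisjoint (λ _ → s) arcs
    arcs-sDisjoint {s} M≤ns i = injection⇒∣p∣≤ colours lap lap-injective
      where
      colours = tabulate (λ j → lookup (arcs j) i)
      on-arc : ∀ {j} → j ∈ colours → ∃[ a ] a < size j × toℕ i ≡ (start j + a) % n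
      on-arc {j} p = ∈-arc⁻ {start j} {size j}
        (lookup⇒[]= i (arcs j) (trans (sym (lookup∘tabulate _ j)) ([]=⇒lookup p)))
      offset<L : ∀ {j} (p : j ∈ colours) → proj₁ (on-arc p) < L
      offset<L p = <-≤-trans (proj₁ (proj₂ (on-arc p))) (m⊓n≤m L _)
      point : ∀ {j} → j ∈ colours → ℕ
      point {j} p = start j + proj₁ (on-arc p)
      point<M : ∀ {j} (p : j ∈ colours) → point p < M
      point<M {j} p = m<o∸n⇒n+m<o (start j) (<-≤-trans (proj₁ (proj₂ (on-arc p))) (m⊓n≤n L _))
      lap< : ∀ {j} (p : j ∈ colours) → point p / n < s
      lap< p = m<n*o⇒m/o<n (<-≤-trans (point<M p) (≤-trans M≤ns (≤-reflexive (*-comm n s))))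
      lap : ∀ {j} → j ∈ colours → Fin s
      lap p = fromℕ< (lap< p)
      lap-injective : ∀ {j j′} (p : j ∈ colours) (q : j′ ∈ colours) → lap p ≡ lap q → j ≡ j′
      lap-injective {j} {j′} p q eq =
        Fin.toℕ-injective (m*o+p≡n*o+q⇒m≡n (toℕ j) (toℕ j′) (offset<L p) (offset<L q)
        (%-/-injective (trans (sym (proj₂ (proj₂ (on-arc p)))) (proj₂ (proj₂ (on-arc q))))
          (trans (sym (Fin.toℕ-fromℕ< (lap< p))) (trans (cong toℕ eq) (Fin.toℕ-fromℕ< (lap< q))))))

isMaxAdmissible : ∀ r n k t s .{{_ : NonZero t}} → t * suc k ≤ n →
  IsMaxAdmissible r (λ _ → s) (StableFamily n (suc k) t) (r * (t * k) ⊓ (n * s))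
isMaxAdmissible r n k t s N≤n =
  (arcs r L M , (arcs-sDisjoint r L M (m⊓n≤n _ _) , arcs-avoid r L M t≤n ≤-refl) ,
   totalSize-arcs r L M L≤n (m⊓n≤m _ _)) ,
  optimal
  where
  instance
    n≢0 : NonZero n
    n≢0 = >-nonZero (<-≤-trans (>-nonZero⁻¹ (t * suc k) {{m*n≢0 t (suc k)}}) N≤n)
  L = t * k
  M = r * L ⊓ (n * s)
  t≤n : t ≤ n
  t≤n = ≤-trans (m≤m*n t (suc k)) N≤n
  L≤n : L ≤ n
  L≤n = ≤-trans (*-monoʳ-≤ t (n≤1+n k)) N≤n
  optimal : ∀ (R : Fin r → Subset n) → Admissible (λ _ → s) (StableFamily n (suc k) t) R →
            totalSize R ≤ M
  optimal R (disjoint , avoids) = ⊓-glb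
    (totalSize≤ {R = R} (λ j → ∣avoiding∣≤ N≤n (R j) (λ S stable → avoids S j stable)))
    (≤-trans (totalSize≤nbar {R = R} disjoint) (≤-reflexive (nbar-const n s)))

lemma3p2 : (r n k t s : ℕ) → 2 ≤ r → 2 ≤ k → k ≤ n → 1 ≤ t → 1 ≤ s → s < r →
    t * k ≤ n →
    IsColorabilityDefect {n} r (λ _ → s) (StableFamily n k t) ((n * s) ∸ (t * r * (k ∸ 1)))
lemma3p2 r n zero    t         s _ () _ _  _ _ _
lemma3p2 r n (suc k) zero      s _ _  _ () _ _ _
lemma3p2 r n (suc k) t@(suc _) s _ _  _ _  _ _ N≤n =
  r * (t * k) ⊓ (n * s) , isMaxAdmissible r n k t s N≤n , defect+max≡nbar
  where
  open ≡-Reasoning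
  X = r * (t * k)
  defect+max≡nbar : n * s ∸ t * r * k + X ⊓ (n * s) ≡ nbar {n} (λ _ → s)
  defect+max≡nbar = begin
    n * s ∸ t * r * k + X ⊓ (n * s)   ≡⟨ cong (λ x → n * s ∸ x + X ⊓ (n * s)) (trk≡rtk t r k) ⟩
    n * s ∸ X + X ⊓ (n * s)           ≡⟨ +-comm (n * s ∸ X) (X ⊓ (n * s)) ⟩
    X ⊓ (n * s) + (n * s ∸ X)         ≡⟨ m⊓n+n∸m≡n X (n * s) ⟩
    n * s                             ≡⟨ nbar-const n s ⟨
    nbar {n} (λ _ → s)                ∎
    where
    trk≡rtk : ∀ t r k → t * r * k ≡ r * (t * k)
    trk≡rtk = solve-∀
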